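{- Let $P$ be a uniformly continuously searchable closeness space with a fixed searcher $\mathcal{E}_P$, let $O$ be a pseudocloseness space, let $M:P\to O$ be uniformly continuous, let $\Omega\in O$ be synthetically constructed from $M$ (i.e. $\Omega=M(k)$ for some $k\in P$), and let $\Psi:O\to O$ be a distortion function. For $\varepsilon\in\mathbb{N}$ and $\Theta\in O$ define $\mathrm{reg}(\varepsilon,M,\Theta):=\mathcal{E}_P\big(p\mapsto C_\varepsilon(M(p),\Theta)\big)$. Then for every $\varepsilon\in\mathbb{N}$, the regressed oracle $\omega:=M(\mathrm{reg}(\varepsilon,M,\Psi(\Omega)))$ is such that if $C_\varepsilon(\Psi(\Omega),\Omega)$ then $C_\varepsilon(\omega,\Omega)$.
   Context: Constructive type theory. $\mathbb{N}_\infty$: decreasing binary sequences; $\underline{n}$: $n$ ones then zeros; $\infty$: all ones; $u\preceq v$ iff $\forall n\,(u_n=1\Rightarrow v_n=1)$; $\min$ pointwise. A closeness space is a type with $c:X\to X\to\mathbb{N}_\infty$ satisfying $c(x,y)=\infty\iff x=y$, symmetry, and $\min(c(x,y),c(y,z))\preceq c(x,z)$; a pseudocloseness space satisfies the same except only $x=y\Rightarrow c(x,y)=\infty$. $C_\varepsilon(x,y)$ means $\underline{\varepsilon}\preceq c(x,y)$. $M$ is uniformly continuous if for each $\varepsilon$ there is $\delta$ with $C_\delta(p_1,p_2)\Rightarrow C_\varepsilon(M(p_1),M(p_2))$. A predicate $p$ on $P$ is decidable if each $p(x)$ is decided, uniformly continuous if there is $\delta$ with $C_\delta(x_1,x_2)\Rightarrow(p(x_1)\Leftrightarrow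 p(x_2))$. A searcher on $P$ is a function $\mathcal{E}_P$ sending each decidable predicate $p$ given with a modulus of uniform continuity to $\mathcal{E}_P(p)\in P$ such that if some $x$ satisfies $p$ then $p(\mathcal{E}_P(p))$; $P$ is uniformly continuously searchable if it has a searcher. -}

module Defs where

open import Level using (Level; _⊔_) renaming (suc to lsuc; zero to lzero)
open import Data.Bool using (Bool; true; false; T; _∧_)
open import Data.Unit using (tt)
open import Data.Empty using (⊥-elim)
open import Data.Nat using (ℕ; zero; suc; _<ᵇ_; _<_)
open import Data.Nat.Properties using (<ᵇ⇒<; <⇒<ᵇ; m<1+n⇒m<n∨m≡n; n<1+n)
open import Data.Product using (Σ; Σ-syntax; _×_; _,_; proj₁; proj₂)
open import Data.Sum using (inj₁; inj₂)
open import Relation.Nullary using (Dec; yes; no; ¬_)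
open import Relation.Binary.PropositionalEquality using (_≡_; refl; subst)

decreasing : (ℕ → Bool) → Set
decreasing α = ∀ n → T (α (suc n)) → T (α n)

ℕ∞ : Set
ℕ∞ = Σ (ℕ → Bool) decreasing

ι : ℕ → ℕ∞
ι n = (λ i → i <ᵇ n) , dec
  where
  dec : ∀ i → T (suc i <ᵇ n) → T (i <ᵇ n)
  dec i h = <⇒<ᵇ (Data.Nat.Properties.<-trans (n<1+n i) (<ᵇ⇒< (suc i) n h))

∞ : ℕ∞
∞ = (λ _ → true) , (λ _ _ → tt)

_≼_ : ℕ∞ → ℕ∞ → Set
u ≼ v = ∀ n → T (proj₁ u n) → T (proj₁ v n)

-- equality of elements of ℕ∞, taken pointwise (no funext in Agda)
_≈∞_ : ℕ∞ → ℕ∞ → Set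
u ≈∞ v = ∀ n → proj₁ u n ≡ proj₁ v n

min∞ : ℕ∞ → ℕ∞ → ℕ∞
min∞ u v = (λ n → proj₁ u n ∧ proj₁ v n) , dec
  where
  dec : ∀ n → T (proj₁ u (suc n) ∧ proj₁ v (suc n)) → T (proj₁ u n ∧ proj₁ v n)
  dec n h with proj₁ u (suc n) | proj₂ u n | proj₁ v (suc n) | proj₂ v n
  ... | true | hu | true | hv with proj₁ u n | hu tt | proj₁ v n | hv tt
  ...   | true | _ | true | _ = tt

record IsPseudoCloseness {𝓤 : Level} (X : Set 𝓤) (c : X → X → ℕ∞) : Set 𝓤 where
  field
    eq→∞   : ∀ x y → x ≡ y → c x y ≈∞ ∞
    symm    : ∀ x y → c x y ≈∞ c y x
    ultra   : ∀ x y z → min∞ (c x y) (c y z) ≼ c x z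

record IsCloseness {𝓤 : Level} (X : Set 𝓤) (c : X → X → ℕ∞) : Set 𝓤 where
  field
    isPseudo : IsPseudoCloseness X c
    ∞→eq     : ∀ x y → c x y ≈∞ ∞ → x ≡ y
  open IsPseudoCloseness isPseudo public

record ClosenessSpace (𝓤 : Level) : Set (lsuc 𝓤) where
  field
    ⟨_⟩         : Set 𝓤
    c           : ⟨_⟩ → ⟨_⟩ → ℕ∞
    isCloseness : IsCloseness ⟨_⟩ c
  open IsCloseness isCloseness public

record PseudoClosenessSpace (𝓤 : Level) : Set (lsuc 𝓤) where
  field
    ⟨_⟩               : Set 𝓤
    c                 : ⟨_⟩ → ⟨_⟩ → ℕ∞
    isPseudoCloseness : IsPseudoCloseness ⟨_⟩ c
  open IsPseudoCloseness isPseudoCloseness public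

open ClosenessSpace using (⟨_⟩) public
open PseudoClosenessSpace renaming (⟨_⟩ to ⟪_⟫) using () public

C : ∀ {𝓤} {X : Set 𝓤} → (X → X → ℕ∞) → ℕ → X → X → Set
C c ε x y = ι ε ≼ c x y

C[_] : ∀ {𝓤} (X : ClosenessSpace 𝓤) → ℕ → ⟨ X ⟩ → ⟨ X ⟩ → Set
C[ X ] = C (ClosenessSpace.c X)

Cp[_] : ∀ {𝓤} (X : PseudoClosenessSpace 𝓤) → ℕ → ⟪ X ⟫ → ⟪ X ⟫ → Set
Cp[ X ] = C (PseudoClosenessSpace.c X)

UniformlyContinuous : ∀ {𝓤 𝓥} (P : ClosenessSpace 𝓤) (O : PseudoClosenessSpace 𝓥)
                      → (⟨ P ⟩ → ⟪ O ⟫) → Set 𝓤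
UniformlyContinuous P O M =
  ∀ ε → Σ[ δ ∈ ℕ ] (∀ p₁ p₂ → C[ P ] δ p₁ p₂ → Cp[ O ] ε (M p₁) (M p₂))

record UCPredicate {𝓤} (P : ClosenessSpace 𝓤) : Set (lsuc lzero ⊔ 𝓤) where
  field
    pred  : ⟨ P ⟩ → Set
    dec   : ∀ x → Dec (pred x)
    δ     : ℕ
    ucont : ∀ x₁ x₂ → C[ P ] δ x₁ x₂ → (pred x₁ → pred x₂) × (pred x₂ → pred x₁)

record Searcher {𝓤} (P : ClosenessSpace 𝓤) : Set (lsuc lzero ⊔ 𝓤) where
  field
    ℰ    : UCPredicate P → ⟨ P ⟩
    spec : (p : UCPredicate P) → Σ[ x ∈ ⟨ P ⟩ ] UCPredicate.pred p x
         → UCPredicate.pred p (ℰ p)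

C-dec : ∀ ε (u : ℕ∞) → Dec (ι ε ≼ u)
C-dec zero u = yes (λ n ())
C-dec (suc ε) u with C-dec ε u | proj₁ u ε in eq
... | no ¬h | _ = no (λ h → ¬h (λ n t → h n (<⇒<ᵇ (Data.Nat.Properties.<-trans (<ᵇ⇒< n ε t) (n<1+n ε)))))
... | yes h | false = no (λ h' → subst T eq (h' ε (<⇒<ᵇ (n<1+n ε))))
... | yes h | true = yes go
  where
  go : ι (suc ε) ≼ u
  go n t with m<1+n⇒m<n∨m≡n (<ᵇ⇒< n (suc ε) t)
  ... | inj₁ n<ε = h n (<⇒<ᵇ n<ε)
  ... | inj₂ refl = subst T (Relation.Binary.PropositionalEquality.sym eq) tt

module _ {𝓥} (O : PseudoClosenessSpace 𝓥) where
  open PseudoClosenessSpace O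

  C-sym : ∀ ε x y → Cp[ O ] ε x y → Cp[ O ] ε y x
  C-sym ε x y h n t = subst T (symm x y n) (h n t)

  C-trans : ∀ ε x y z → Cp[ O ] ε x y → Cp[ O ] ε y z → Cp[ O ] ε x z
  C-trans ε x y z h₁ h₂ n t = ultra x y z n (both (proj₁ (c x y) n) (proj₁ (c y z) n) (h₁ n t) (h₂ n t))
    where
    both : ∀ a b → T a → T b → T (a ∧ b)
    both true true _ _ = tt

module _ {𝓤 𝓥} (P : ClosenessSpace 𝓤) (O : PseudoClosenessSpace 𝓥) where

  regPredicate : (ε : ℕ) (M : ⟨ P ⟩ → ⟪ O ⟫) → UniformlyContinuous P O M
               → ⟪ O ⟫ → UCPredicate P
  regPredicate ε M ucM Θ = record
    { pred  = λ p → Cp[ O ] ε (M p) Θ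
    ; dec   = λ p → C-dec ε (PseudoClosenessSpace.c O (M p) Θ)
    ; δ     = proj₁ (ucM ε)
    ; ucont = λ x₁ x₂ h →
        let m = proj₂ (ucM ε) x₁ x₂ h in
          (λ a → C-trans O ε (M x₂) (M x₁) Θ (C-sym O ε (M x₁) (M x₂) m) a)
        , (λ b → C-trans O ε (M x₁) (M x₂) Θ m b)
    }

  reg : Searcher P → (ε : ℕ) (M : ⟨ P ⟩ → ⟪ O ⟫) → UniformlyContinuous P O M
      → ⟪ O ⟫ → ⟨ P ⟩
  reg 𝓔 ε M ucM Θ = Searcher.ℰ 𝓔 (regPredicate ε M ucM Θ)

module Submission where

-- Ω = M k is itself a solution of the regression predicate p ↦ C_ε(M p, Ψ Ω)
-- (by symmetry of the hypothesis), so the searcher returns a solution ω'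
-- with C_ε(M ω', Ψ Ω); chaining with C_ε(Ψ Ω, Ω) gives C_ε(M ω', Ω).

open import Defs
open import Level using (Level)
open import Data.Nat using (ℕ)
open import Data.Product using (Σ-syntax; _,_)
open import Relation.Binary.PropositionalEquality using (_≡_; refl)

module _ {𝓤 𝓥 : Level} (P : ClosenessSpace 𝓤) (O : PseudoClosenessSpace 𝓥) where

  reg-close : (𝓔 : Searcher P) (ε : ℕ) (M : ⟨ P ⟩ → ⟪ O ⟫)
              (ucM : UniformlyContinuous P O M) (Θ : ⟪ O ⟫)
            → Σ[ k ∈ ⟨ P ⟩ ] Cp[ O ] ε (M k) Θ
            → Cp[ O ] ε (M (reg P O 𝓔 ε M ucM Θ)) Θ
  reg-close 𝓔 ε M ucM Θ = Searcher.spec 𝓔 (regPredicate P O ε M ucM Θ)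

theorem4p37 : {𝓤 𝓥 : Level} (P : ClosenessSpace 𝓤) (𝓔 : Searcher P)
    (O : PseudoClosenessSpace 𝓥) (M : ⟨ P ⟩ → ⟪ O ⟫)
    (ucM : UniformlyContinuous P O M)
    (Ω : ⟪ O ⟫) → Σ[ k ∈ ⟨ P ⟩ ] (Ω ≡ M k)
    → (Ψ : ⟪ O ⟫ → ⟪ O ⟫) (ε : ℕ)
    → Cp[ O ] ε (Ψ Ω) Ω
    → Cp[ O ] ε (M (reg P O 𝓔 ε M ucM (Ψ Ω))) Ω
theorem4p37 P 𝓔 O M ucM .(M k) (k , refl) Ψ ε ΨΩ-close =
  C-trans O ε ω (Ψ (M k)) (M k) ω-close ΨΩ-close
  where
  ω = M (reg P O 𝓔 ε M ucM (Ψ (M k)))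

  ω-close : Cp[ O ] ε ω (Ψ (M k))
  ω-close = reg-close P O 𝓔 ε M ucM (Ψ (M k))
              (k , C-sym O ε (Ψ (M k)) (M k) ΨΩ-close)
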